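{- Let $p$ be an odd prime and let $\mathcal E=\mathcal T(a_1,\dots,a_k)$ with $k\ge 4$ and $\gcd(a_1,\dots,a_k)=1$ be a regular triangular form that is $p$-unstable, i.e. $\overline{DQ_p(a_1,\dots,a_k)}\ne\mathbb Z_p$. Then $\lambda_p(\mathcal E)$ is also regular.
   Context: For positive integers $c_1,\dots,c_k$, $\mathcal T(c_1,\dots,c_k)$ denotes the triangular form $c_1\frac{x_1(x_1+1)}{2}+\cdots+c_k\frac{x_k(x_k+1)}{2}$; $n\ge0$ is represented by it if it equals the form at a point of $\mathbb Z^k$, locally represented if the equation has a solution in $\mathbb Z_q^k$ for every prime $q$; the form is regular if it represents every positive integer it locally represents. $\overline{DQ_p(c_1,\dots,c_k)}=\{\gamma\in\mathbb Z_p:\gamma=c_1y_1^2+\cdots+c_ky_k^2,\ y_i\in\mathbb Z_p\}$. Watson transformation: for $\mathbf a=(a_1,\dots,a_k)$ with $\gcd=1$ and odd prime $p$, let $s_i=0$ if $p\mid a_i$ and $s_i=2$ otherwise, and $s=\min_i \mathrm{ord}_p(p^{s_i}a_i)\in\{1,2\}$; then $\lambda_p(\mathcal T(\mathbf a))=\mathcal T(p^{s_1-s}a_1,\dots,p^{s_k-s}a_k)$. -}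

module Defs where

open import Data.Nat as ℕ using (ℕ; zero; suc; _+_; _*_; _^_; _<_; _≤_)
open import Data.Nat.DivMod using (_/_)
open import Data.Nat.GCD using (gcd)
open import Data.Nat.Divisibility using (_∣?_)
open import Data.Nat.Primality using (Prime)
open import Data.Integer as ℤ using (ℤ; +_; ∣_∣)
open import Data.Integer.Divisibility as ℤD using ()
open import Data.Fin using (Fin; zero; suc)
open import Data.Product using (Σ; ∃; _×_)
open import Relation.Nullary using (¬_; yes; no)
open import Relation.Binary.PropositionalEquality using (_≡_)

sumF : (k : ℕ) → (Fin k → ℕ) → ℕ
sumF zero    f = 0
sumF (suc k) f = f zero + sumF k (λ i → f (suc i))

gcdF : (k : ℕ) → (Fin k → ℕ) → ℕ
gcdF zero    a = 0
gcdF (suc k) a = gcd (a zero) (gcdF k (λ i → a (suc i)))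

Cong : ℕ → ℕ → ℕ → Set
Cong n a b = (+ n) ℤD.∣ ((+ a) ℤ.- (+ b))

-- triangular number y(y+1)/2 on ℕ and on ℤ (for z ∈ ℤ, z(z+1) ≥ 0)
triN : ℕ → ℕ
triN y = (y * suc y) / 2

triZ : ℤ → ℕ
triZ z = ∣ z ℤ.* (z ℤ.+ ℤ.1ℤ) ∣ / 2

triForm : (k : ℕ) → (Fin k → ℕ) → (Fin k → ℤ) → ℕ
triForm k c x = sumF k (λ i → c i * triZ (x i))

Represents : (k : ℕ) → (Fin k → ℕ) → ℕ → Set
Represents k c n = Σ (Fin k → ℤ) (λ x → triForm k c x ≡ n)

-- q-adic integers as the inverse limit of ℤ/q^m: an element is given by a
-- sequence of natural representatives x m of its residue mod q^m, compatible
-- under reduction (elements are equal iff all residues agree).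
Zq : ℕ → Set
Zq q = Σ (ℕ → ℕ) (λ x → (m : ℕ) → Cong (q ^ m) (x (suc m)) (x m))

seq : {q : ℕ} → Zq q → ℕ → ℕ
seq (x Data.Product., _) = x

-- n = T(c)(x) has a solution x ∈ ℤ_q^k.  The residue of T(x_i) mod q^m is
-- computed from the residue of x_i mod q^(m+1) (well defined, also for q = 2).
LocRepAt : ℕ → (k : ℕ) → (Fin k → ℕ) → ℕ → Set
LocRepAt q k c n =
  Σ (Fin k → Zq q) (λ x →
    (m : ℕ) → Cong (q ^ m) (sumF k (λ i → c i * triN (seq (x i) (suc m)))) n)

LocRep : (k : ℕ) → (Fin k → ℕ) → ℕ → Set
LocRep k c n = (q : ℕ) → Prime q → LocRepAt q k c n

Regular : (k : ℕ) → (Fin k → ℕ) → Set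
Regular k c = (n : ℕ) → 0 < n → LocRep k c n → Represents k c n

-- γ ∈ closure of DQ_p(c): γ = Σ c_i y_i^2 with y_i ∈ ℤ_p
InDQ : (p : ℕ) → (k : ℕ) → (Fin k → ℕ) → Zq p → Set
InDQ p k c γ =
  Σ (Fin k → Zq p) (λ y →
    (m : ℕ) → Cong (p ^ m) (sumF k (λ i → c i * (seq (y i) m * seq (y i) m))) (seq γ m))

Unstable : (p : ℕ) → (k : ℕ) → (Fin k → ℕ) → Set
Unstable p k c = Σ (Zq p) (λ γ → ¬ InDQ p k c γ)

sIdx : (p : ℕ) → {k : ℕ} → (Fin k → ℕ) → Fin k → ℕ
sIdx p a i with p ∣? a i
... | yes _ = 0
... | no  _ = 2

scaled : (p : ℕ) → {k : ℕ} → (Fin k → ℕ) → Fin k → ℕ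
scaled p a i = p ^ sIdx p a i * a i

-- s = min_i ord_p(p^{s_i} a_i): p^s divides every p^{s_i} a_i and
-- p^{s+1} fails to divide some of them
IsMinOrd : (p : ℕ) → (k : ℕ) → (Fin k → ℕ) → ℕ → Set
IsMinOrd p k a s =
  ((i : Fin k) → p ^ s Data.Nat.Divisibility.∣ scaled p a i) ×
  ∃ (λ (i : Fin k) → ¬ (p ^ suc s Data.Nat.Divisibility.∣ scaled p a i))

-- b = λ_p(a): b_i = p^{s_i - s} a_i, i.e. p^s b_i = p^{s_i} a_i
IsWatson : (p : ℕ) → (k : ℕ) → (Fin k → ℕ) → (Fin k → ℕ) → Set
IsWatson p k a b =
  Σ ℕ (λ s → IsMinOrd p k a s × ((i : Fin k) → p ^ s * b i ≡ scaled p a i))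

-- Write p = 2h + 1. The substitution x_i ↦ p x_i + h on the coordinates with p ∤ a_i turns
-- T(a) into p^s T(b) + D, so if T(b) locally represents n then T(a) locally represents
-- p^s n + D and, being regular, represents it by some u. If p ∣ a_i or p ∣ 2u_i + 1 for every
-- i, then u is the image of a solution of T(b) = n. Otherwise w_i = 2u_i + 1 satisfies
-- Σ a_i w_i² = 8 (p^s n + D) + Σ a_i ≡ 0 (mod p) while p ∤ 2 a_j w_j for some j; along the line
-- λ w + e_j the form Σ a_i y_i² is a quadratic in λ that is linear mod p, and Hensel lifting
-- shows that it takes every value in ℤ_p, contradicting p-instability.
module Submission where

open import Defs
open import Data.Nat as ℕ using (ℕ; zero; suc; _+_; _*_; _^_; _<_; _≤_)
import Data.Nat.Properties as ℕ
open import Data.Nat.DivMod using (_/_; m*n/n≡m)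
open import Data.Nat.Divisibility as ℕ∣ using (_∣_; divides; _∣?_)
open import Data.Nat.Primality using (Prime; prime⇒nonZero; euclidsLemma; ¬prime[1]; irreducible[2]; prime⇒irreducible)
open import Data.Nat.Coprimality using (Coprime; coprime-Bézout)
open import Data.Nat.GCD using (module Bézout)
open import Data.Integer as ℤ using (ℤ; +_; -[1+_])
import Data.Integer.Properties as ℤ
open import Data.Integer.DivMod using (_%ℕ_; _/ℕ_; a≡a%ℕn+[a/ℕn]*n)
open import Data.Integer.Divisibility.Signed as ℤ∣ using (∣ᵤ⇒∣; ∣⇒∣ᵤ)
  renaming (_∣_ to _∣ℤ_; divides to dividesℤ)
open import Data.Fin using (Fin; zero; suc)
open import Data.Fin.Properties using (all?; ¬∀⟶∃¬)
open import Data.Product using (Σ; ∃; _,_; proj₁; proj₂)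
open import Data.Sum using (_⊎_; inj₁; inj₂; [_,_]′)
open import Function using (id)
open import Relation.Nullary.Decidable using (_⊎-dec_)
open import Relation.Nullary using (¬_; Dec; yes; no; contradiction)
open import Relation.Binary.PropositionalEquality
open import Data.Nat.Tactic.RingSolver using (solve-∀)
import Data.Integer.Tactic.RingSolver as ℤRing

open ≡-Reasoning

tri : ℕ → ℕ
tri zero    = 0
tri (suc y) = suc y + tri y

tri-double : ∀ y → y * suc y ≡ tri y * 2
tri-double zero    = refl
tri-double (suc y) = begin
  suc y * (2 + y)              ≡⟨ split y ⟩
  suc y * 2 + y * suc y        ≡⟨ cong (λ t → suc y * 2 + t) (tri-double y) ⟩
  suc y * 2 + tri y * 2        ≡⟨ ℕ.*-distribʳ-+ 2 (suc y) (tri y) ⟨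
  tri (suc y) * 2              ∎
  where
  split : ∀ y → (1 + y) * (2 + y) ≡ (1 + y) * 2 + y * (1 + y)
  split = solve-∀

triN≡tri : ∀ y → triN y ≡ tri y
triN≡tri y = trans (cong (_/ 2) (tri-double y)) (m*n/n≡m (tri y) 2)

-- the reflection z ↦ -1 - z fixes z (z + 1)
reflectNeg : ℤ → ℕ
reflectNeg (+ n)    = n
reflectNeg -[1+ n ] = n

triZ≡tri∘reflectNeg : ∀ z → triZ z ≡ tri (reflectNeg z)
triZ≡tri∘reflectNeg z = begin
  ℤ.∣ z ℤ.* (z ℤ.+ ℤ.1ℤ) ∣ / 2             ≡⟨ cong (_/ 2) (ℤ.abs-* z (z ℤ.+ ℤ.1ℤ)) ⟩
  ℤ.∣ z ∣ * ℤ.∣ z ℤ.+ ℤ.1ℤ ∣ / 2           ≡⟨ cong (_/ 2) (abs-product z) ⟩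
  reflectNeg z * suc (reflectNeg z) / 2       ≡⟨ triN≡tri (reflectNeg z) ⟩
  tri (reflectNeg z)                          ∎
  where
  abs-product : ∀ z → ℤ.∣ z ∣ * ℤ.∣ z ℤ.+ ℤ.1ℤ ∣ ≡ reflectNeg z * suc (reflectNeg z)
  abs-product (+ n)          = cong (n *_) (ℕ.+-comm n 1)
  abs-product -[1+ zero ]    = refl
  abs-product -[1+ suc n ]   = ℕ.*-comm (suc (suc n)) (suc n)

odd-square : ∀ u → suc (2 * u) * suc (2 * u) ≡ 8 * tri u + 1
odd-square u = begin
  suc (2 * u) * suc (2 * u)   ≡⟨ lhs u ⟩
  4 * (u * suc u) + 1         ≡⟨ cong (λ t → 4 * t + 1) (tri-double u) ⟩
  4 * (tri u * 2) + 1         ≡⟨ rhs (tri u) ⟩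
  8 * tri u + 1               ∎
  where
  lhs : ∀ u → (1 + 2 * u) * (1 + 2 * u) ≡ 4 * (u * (1 + u)) + 1
  lhs = solve-∀
  rhs : ∀ T → 4 * (T * 2) + 1 ≡ 8 * T + 1
  rhs = solve-∀

tri-odd-affine : ∀ h x → tri (suc (2 * h) * x + h) ≡ suc (2 * h) * suc (2 * h) * tri x + tri h
tri-odd-affine h x = ℕ.*-cancelʳ-≡ _ _ 2 (begin
  tri (p * x + h) * 2                   ≡⟨ tri-double (p * x + h) ⟨
  (p * x + h) * suc (p * x + h)         ≡⟨ expand h x ⟩
  p * p * (x * suc x) + h * suc h       ≡⟨ cong₂ (λ u v → p * p * u + v) (tri-double x) (tri-double h) ⟩
  p * p * (tri x * 2) + tri h * 2       ≡⟨ collect p (tri x) (tri h) ⟩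
  (p * p * tri x + tri h) * 2           ∎)
  where
  p = suc (2 * h)
  expand : ∀ h x → ((1 + 2 * h) * x + h) * (1 + ((1 + 2 * h) * x + h))
                 ≡ (1 + 2 * h) * (1 + 2 * h) * (x * (1 + x)) + h * (1 + h)
  expand = solve-∀
  collect : ∀ P T H → P * P * (T * 2) + H * 2 ≡ (P * P * T + H) * 2
  collect = solve-∀

sumF-cong : ∀ k {f g : Fin k → ℕ} → (∀ i → f i ≡ g i) → sumF k f ≡ sumF k g
sumF-cong zero    f≡g = refl
sumF-cong (suc k) f≡g = cong₂ _+_ (f≡g zero) (sumF-cong k (λ i → f≡g (suc i)))

sumF-+ : ∀ k (f g : Fin k → ℕ) → sumF k (λ i → f i + g i) ≡ sumF k f + sumF k g
sumF-+ zero    f g = refl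
sumF-+ (suc k) f g = begin
  f zero + g zero + sumF k (λ i → f (suc i) + g (suc i))
    ≡⟨ cong (λ t → f zero + g zero + t) (sumF-+ k (λ i → f (suc i)) (λ i → g (suc i))) ⟩
  f zero + g zero + (sumF k (λ i → f (suc i)) + sumF k (λ i → g (suc i)))
    ≡⟨ interchange (f zero) (g zero) _ _ ⟩
  f zero + sumF k (λ i → f (suc i)) + (g zero + sumF k (λ i → g (suc i))) ∎
  where
  interchange : ∀ a b c d → a + b + (c + d) ≡ a + c + (b + d)
  interchange = solve-∀

sumF-* : ∀ k c (f : Fin k → ℕ) → sumF k (λ i → c * f i) ≡ c * sumF k f
sumF-* zero    c f = sym (ℕ.*-zeroʳ c)
sumF-* (suc k) c f = trans (cong (λ t → c * f zero + t) (sumF-* k c (λ i → f (suc i))))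
                           (sym (ℕ.*-distribˡ-+ c (f zero) _))

∣-sumF : ∀ k {d} (f : Fin k → ℕ) → (∀ i → d ∣ f i) → d ∣ sumF k f
∣-sumF zero    f d∣f = _ ℕ∣.∣0
∣-sumF (suc k) f d∣f = ℕ∣.∣m∣n⇒∣m+n (d∣f zero) (∣-sumF k (λ i → f (suc i)) (λ i → d∣f (suc i)))

δ : ∀ {k} → Fin k → Fin k → ℕ
δ zero    zero    = 1
δ zero    (suc i) = 0
δ (suc j) zero    = 0
δ (suc j) (suc i) = δ j i

δ-idem : ∀ {k} (j i : Fin k) → δ j i * δ j i ≡ δ j i
δ-idem zero    zero    = refl
δ-idem zero    (suc i) = refl
δ-idem (suc j) zero    = refl
δ-idem (suc j) (suc i) = δ-idem j i

sumF-δ : ∀ k (j : Fin k) (f : Fin k → ℕ) → sumF k (λ i → f i * δ j i) ≡ f j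
sumF-δ (suc k) zero    f = begin
  f zero * 1 + sumF k (λ i → f (suc i) * 0)  ≡⟨ cong₂ _+_ (ℕ.*-identityʳ (f zero)) (sumF-cong k (λ i → ℕ.*-zeroʳ (f (suc i)))) ⟩
  f zero + sumF k (λ _ → 0)                  ≡⟨ cong (λ t → f zero + t) (sumF-zero k) ⟩
  f zero + 0                                 ≡⟨ ℕ.+-identityʳ (f zero) ⟩
  f zero                                     ∎
  where
  sumF-zero : ∀ k → sumF k (λ _ → 0) ≡ 0
  sumF-zero zero    = refl
  sumF-zero (suc k) = sumF-zero k
sumF-δ (suc k) (suc j) f = trans (cong (_+ sumF k (λ i → f (suc i) * δ j i)) (ℕ.*-zeroʳ (f zero)))
                                 (sumF-δ k j (λ i → f (suc i)))

pos-affine : ∀ c u d → + (c * u + d) ≡ + c ℤ.* + u ℤ.+ + d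
pos-affine c u d = trans (ℤ.pos-+ (c * u) d) (cong (ℤ._+ + d) (ℤ.pos-* c u))

Cong-affine : ∀ {n u v} c d → Cong n u v → Cong n (c * u + d) (c * v + d)
Cong-affine {n} {u} {v} c d u≡v = ∣⇒∣ᵤ (subst (+ n ∣ℤ_) scaled-difference (ℤ∣.∣n⇒∣m*n (+ c) (∣ᵤ⇒∣ u≡v)))
  where
  scaled-difference : + c ℤ.* (+ u ℤ.- + v) ≡ + (c * u + d) ℤ.- + (c * v + d)
  scaled-difference = begin
    + c ℤ.* (+ u ℤ.- + v)                              ≡⟨ cancel-d (+ c) (+ u) (+ v) (+ d) ⟩
    (+ c ℤ.* + u ℤ.+ + d) ℤ.- (+ c ℤ.* + v ℤ.+ + d)   ≡⟨ cong₂ ℤ._-_ (pos-affine c u d) (pos-affine c v d) ⟨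
    + (c * u + d) ℤ.- + (c * v + d)                    ∎
    where
    cancel-d : ∀ C U V D → C ℤ.* (U ℤ.- V) ≡ (C ℤ.* U ℤ.+ D) ℤ.- (C ℤ.* V ℤ.+ D)
    cancel-d = ℤRing.solve-∀

Cong-+* : ∀ n a t → Cong n (a + t * n) a
Cong-+* n a t = ∣⇒∣ᵤ (dividesℤ (+ t) (begin
  + (a + t * n) ℤ.- + a              ≡⟨ cong (ℤ._- + a) (trans (ℤ.pos-+ a (t * n)) (cong (λ z → + a ℤ.+ z) (ℤ.pos-* t n))) ⟩
  + a ℤ.+ + t ℤ.* + n ℤ.- + a         ≡⟨ cancel (+ a) (+ t ℤ.* + n) ⟩
  + t ℤ.* + n                         ∎))
  where
  cancel : ∀ Y X → Y ℤ.+ X ℤ.- Y ≡ X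
  cancel = ℤRing.solve-∀

Zq-limit : ∀ {q} (P : ℕ → ℕ → Set) → P 0 0 →
           (∀ {m l} → P m l → Σ ℕ λ t → P (suc m) (l + t * q ^ m)) →
           Σ (Zq q) λ x → ∀ m → P m (seq x m)
Zq-limit {q} P P₀ step = ((λ m → proj₁ (approx m)) , compatible) , (λ m → proj₂ (approx m))
  where
  lift : ∀ {m} → Σ ℕ (P m) → Σ ℕ (P (suc m))
  lift {m} (l , Pl) = l + proj₁ (step Pl) * q ^ m , proj₂ (step Pl)
  approx : ∀ m → Σ ℕ (P m)
  approx zero    = 0 , P₀
  approx (suc m) = lift (approx m)
  compatible : ∀ m → Cong (q ^ m) (proj₁ (approx (suc m))) (proj₁ (approx m))
  compatible m = Cong-+* (q ^ m) (proj₁ (approx m)) (proj₁ (step (proj₂ (approx m))))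

prime∤⇒coprime : ∀ {p n} → Prime p → ¬ p ∣ n → Coprime p n
prime∤⇒coprime p-prime p∤n (d∣p , d∣n) with prime⇒irreducible p-prime d∣p
... | inj₁ d≡1  = d≡1
... | inj₂ refl = contradiction d∣n p∤n

invertible-mod-prime : ∀ {p B} → Prime p → ¬ p ∣ B → Σ ℤ λ B⁻¹ → + p ∣ℤ (+ B ℤ.* B⁻¹ ℤ.- ℤ.1ℤ)
invertible-mod-prime {p} {B} p-prime p∤B with coprime-Bézout (prime∤⇒coprime p-prime p∤B)
... | Bézout.+- x y eq = ℤ.- + y , dividesℤ (ℤ.- + x) (begin
  + B ℤ.* ℤ.- + y ℤ.- ℤ.1ℤ              ≡⟨ rearrange (+ B) (+ y) ⟩
  ℤ.- (+ y ℤ.* + B ℤ.+ ℤ.1ℤ)             ≡⟨ cong ℤ.-_ (pos-affine y B 1) ⟨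
  ℤ.- + (y * B + 1)                      ≡⟨ cong (λ z → ℤ.- + z) (trans (ℕ.+-comm (y * B) 1) eq) ⟩
  ℤ.- + (x * p)                          ≡⟨ cong ℤ.-_ (ℤ.pos-* x p) ⟩
  ℤ.- (+ x ℤ.* + p)                      ≡⟨ ℤ.neg-distribˡ-* (+ x) (+ p) ⟩
  ℤ.- + x ℤ.* + p                        ∎)
  where
  rearrange : ∀ B y → B ℤ.* ℤ.- y ℤ.- ℤ.1ℤ ≡ ℤ.- (y ℤ.* B ℤ.+ ℤ.1ℤ)
  rearrange = ℤRing.solve-∀
... | Bézout.-+ x y eq = + y , dividesℤ (+ x) (begin
  + B ℤ.* + y ℤ.- ℤ.1ℤ                   ≡⟨ cong (ℤ._- ℤ.1ℤ) (trans (ℤ.pos-* y B) (ℤ.*-comm (+ y) (+ B))) ⟨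
  + (y * B) ℤ.- ℤ.1ℤ                      ≡⟨ cong (λ z → + z ℤ.- ℤ.1ℤ) (trans (sym eq) (ℕ.+-comm 1 (x * p))) ⟩
  + (x * p + 1) ℤ.- ℤ.1ℤ                  ≡⟨ cong (ℤ._- ℤ.1ℤ) (pos-affine x p 1) ⟩
  + x ℤ.* + p ℤ.+ ℤ.1ℤ ℤ.- ℤ.1ℤ           ≡⟨ cancel (+ x ℤ.* + p) ⟩
  + x ℤ.* + p                             ∎)
  where
  cancel : ∀ X → X ℤ.+ ℤ.1ℤ ℤ.- ℤ.1ℤ ≡ X
  cancel = ℤRing.solve-∀

linear-congruence-mod-prime : ∀ {p B} → Prime p → ¬ p ∣ B → (e : ℤ) → Σ ℕ λ t → + p ∣ℤ (+ t ℤ.* + B ℤ.- e)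
linear-congruence-mod-prime {p} {B} p-prime p∤B e = t , subst (+ p ∣ℤ_) (sym tB-e) p∣rhs
  where
  instance _ = prime⇒nonZero p-prime
  B⁻¹ = proj₁ (invertible-mod-prime p-prime p∤B)
  t = (e ℤ.* B⁻¹) %ℕ p
  r = (e ℤ.* B⁻¹) /ℕ p
  tB-e : + t ℤ.* + B ℤ.- e ≡ e ℤ.* (+ B ℤ.* B⁻¹ ℤ.- ℤ.1ℤ) ℤ.- r ℤ.* + B ℤ.* + p
  tB-e = begin
    + t ℤ.* + B ℤ.- e                                  ≡⟨ solve-for-t (+ t) (r ℤ.* + p) (+ B) e ⟩
    (+ t ℤ.+ r ℤ.* + p) ℤ.* + B ℤ.- e ℤ.- r ℤ.* + p ℤ.* + B   ≡⟨ cong (λ z → z ℤ.* + B ℤ.- e ℤ.- r ℤ.* + p ℤ.* + B) (a≡a%ℕn+[a/ℕn]*n (e ℤ.* B⁻¹) p) ⟨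
    e ℤ.* B⁻¹ ℤ.* + B ℤ.- e ℤ.- r ℤ.* + p ℤ.* + B      ≡⟨ factor e B⁻¹ (+ B) r (+ p) ⟩
    e ℤ.* (+ B ℤ.* B⁻¹ ℤ.- ℤ.1ℤ) ℤ.- r ℤ.* + B ℤ.* + p ∎
    where
    solve-for-t : ∀ T R B e → T ℤ.* B ℤ.- e ≡ (T ℤ.+ R) ℤ.* B ℤ.- e ℤ.- R ℤ.* B
    solve-for-t = ℤRing.solve-∀
    factor : ∀ e I B r p → e ℤ.* I ℤ.* B ℤ.- e ℤ.- r ℤ.* p ℤ.* B ≡ e ℤ.* (B ℤ.* I ℤ.- ℤ.1ℤ) ℤ.- r ℤ.* B ℤ.* p
    factor = ℤRing.solve-∀
  p∣rhs : + p ∣ℤ (e ℤ.* (+ B ℤ.* B⁻¹ ℤ.- ℤ.1ℤ) ℤ.- r ℤ.* + B ℤ.* + p)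
  p∣rhs = ℤ∣.∣m∣n⇒∣m-n (ℤ∣.∣n⇒∣m*n e (proj₂ (invertible-mod-prime p-prime p∤B))) (ℤ∣.∣n⇒∣m*n (r ℤ.* + B) ℤ∣.∣-refl)

module QuadraticHensel {p F B A : ℕ} (p-prime : Prime p) (p∣F : p ∣ F) (p∤B : ¬ p ∣ B) where

  quadratic : ℕ → ℕ
  quadratic l = l * l * F + l * B + A

  quadraticℤ : ℤ → ℤ
  quadraticℤ L = L ℤ.* L ℤ.* + F ℤ.+ L ℤ.* + B ℤ.+ + A

  pos-quadratic : ∀ l → + quadratic l ≡ quadraticℤ (+ l)
  pos-quadratic l = trans (ℤ.pos-+ (l * l * F + l * B) A) (cong (ℤ._+ + A)
    (trans (ℤ.pos-+ (l * l * F) (l * B))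
           (cong₂ ℤ._+_ (trans (ℤ.pos-* (l * l) F) (cong (ℤ._* + F) (ℤ.pos-* l l))) (ℤ.pos-* l B))))

  quadraticℤ-shift : ∀ L T Q → quadraticℤ (L ℤ.+ T ℤ.* Q)
                               ≡ quadraticℤ L ℤ.+ Q ℤ.* (T ℤ.* + B) ℤ.+ Q ℤ.* (T ℤ.* (+ 2 ℤ.* L ℤ.+ T ℤ.* Q) ℤ.* + F)
  quadraticℤ-shift L T Q = taylor L T Q (+ F) (+ B) (+ A)
    where
    taylor : ∀ L T Q F B A →
      (L ℤ.+ T ℤ.* Q) ℤ.* (L ℤ.+ T ℤ.* Q) ℤ.* F ℤ.+ (L ℤ.+ T ℤ.* Q) ℤ.* B ℤ.+ A
      ≡ (L ℤ.* L ℤ.* F ℤ.+ L ℤ.* B ℤ.+ A) ℤ.+ Q ℤ.* (T ℤ.* B) ℤ.+ Q ℤ.* (T ℤ.* (+ 2 ℤ.* L ℤ.+ T ℤ.* Q) ℤ.* F)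
    taylor = ℤRing.solve-∀

  -- The F-term of the shift is divisible by p Q, so the shift acts modulo p Q as the linear correction Q t B.
  refine : ∀ {Q l c c′} → Cong Q (quadratic l) c → Cong Q c′ c →
           Σ ℕ λ t → Cong (p * Q) (quadratic (l + t * Q)) c′
  refine {Q} {l} {c} {c′} root lift = t , ∣⇒∣ᵤ (subst (+ (p * Q) ∣ℤ_) (sym shift) (ℤ∣.∣m∣n⇒∣m+n pQ∣linear pQ∣curvature))
    where
    L T Qℤ : ℤ
    L = + l
    Qℤ = + Q
    Q∣c′-root : Qℤ ∣ℤ (+ c′ ℤ.- quadraticℤ L)
    Q∣c′-root = subst (Qℤ ∣ℤ_) (trans (difference (+ c′) (+ quadratic l) (+ c)) (cong (λ z → + c′ ℤ.- z) (pos-quadratic l)))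
                      (ℤ∣.∣m∣n⇒∣m-n (∣ᵤ⇒∣ {Qℤ} {+ c′ ℤ.- + c} lift) (∣ᵤ⇒∣ {Qℤ} {+ quadratic l ℤ.- + c} root))
      where
      difference : ∀ X Y Z → (X ℤ.- Z) ℤ.- (Y ℤ.- Z) ≡ X ℤ.- Y
      difference = ℤRing.solve-∀
    e = ℤ∣.quotient Q∣c′-root
    t = proj₁ (linear-congruence-mod-prime p-prime p∤B e)
    T = + t
    curvature : ℤ
    curvature = Qℤ ℤ.* (T ℤ.* (+ 2 ℤ.* L ℤ.+ T ℤ.* Qℤ) ℤ.* + F)
    shift : + quadratic (l + t * Q) ℤ.- + c′ ≡ Qℤ ℤ.* (T ℤ.* + B ℤ.- e) ℤ.+ curvature
    shift = begin
      + quadratic (l + t * Q) ℤ.- + c′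
        ≡⟨ cong (ℤ._- + c′) (trans (pos-quadratic (l + t * Q)) (cong quadraticℤ (ℤ.pos-+ l (t * Q)))) ⟩
      quadraticℤ (L ℤ.+ + (t * Q)) ℤ.- + c′
        ≡⟨ cong (λ z → quadraticℤ (L ℤ.+ z) ℤ.- + c′) (ℤ.pos-* t Q) ⟩
      quadraticℤ (L ℤ.+ T ℤ.* Qℤ) ℤ.- + c′
        ≡⟨ cong (ℤ._- + c′) (quadraticℤ-shift L T Qℤ) ⟩
      quadraticℤ L ℤ.+ Qℤ ℤ.* (T ℤ.* + B) ℤ.+ curvature ℤ.- + c′
        ≡⟨ regroup (quadraticℤ L) (Qℤ ℤ.* (T ℤ.* + B)) curvature (+ c′) ⟩
      Qℤ ℤ.* (T ℤ.* + B) ℤ.- (+ c′ ℤ.- quadraticℤ L) ℤ.+ curvature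
        ≡⟨ cong (λ z → Qℤ ℤ.* (T ℤ.* + B) ℤ.- z ℤ.+ curvature) (ℤ∣._∣_.equality Q∣c′-root) ⟩
      Qℤ ℤ.* (T ℤ.* + B) ℤ.- e ℤ.* Qℤ ℤ.+ curvature
        ≡⟨ factor Qℤ (T ℤ.* + B) e curvature ⟩
      Qℤ ℤ.* (T ℤ.* + B ℤ.- e) ℤ.+ curvature ∎
      where
      regroup : ∀ G X Y C → G ℤ.+ X ℤ.+ Y ℤ.- C ≡ X ℤ.- (C ℤ.- G) ℤ.+ Y
      regroup = ℤRing.solve-∀
      factor : ∀ Q X e Y → Q ℤ.* X ℤ.- e ℤ.* Q ℤ.+ Y ≡ Q ℤ.* (X ℤ.- e) ℤ.+ Y
      factor = ℤRing.solve-∀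
    Qp≡pQ : Qℤ ℤ.* + p ≡ + (p * Q)
    Qp≡pQ = trans (ℤ.*-comm Qℤ (+ p)) (sym (ℤ.pos-* p Q))
    pQ∣linear : + (p * Q) ∣ℤ Qℤ ℤ.* (T ℤ.* + B ℤ.- e)
    pQ∣linear = subst (_∣ℤ Qℤ ℤ.* (T ℤ.* + B ℤ.- e)) Qp≡pQ
                      (ℤ∣.*-monoʳ-∣ Qℤ (proj₂ (linear-congruence-mod-prime p-prime p∤B e)))
    pQ∣curvature : + (p * Q) ∣ℤ curvature
    pQ∣curvature = subst (_∣ℤ curvature) Qp≡pQ
                         (ℤ∣.*-monoʳ-∣ Qℤ (ℤ∣.∣n⇒∣m*n (T ℤ.* (+ 2 ℤ.* L ℤ.+ T ℤ.* Qℤ)) (∣ᵤ⇒∣ {+ p} {+ F} p∣F)))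

  quadratic-onto : (γ : Zq p) → Σ (Zq p) λ x → ∀ m → Cong (p ^ m) (quadratic (seq x m)) (seq γ m)
  quadratic-onto γ = Zq-limit (λ m l → Cong (p ^ m) (quadratic l) (seq γ m)) (ℕ∣.1∣ _)
                              (λ {m} {l} root → refine {p ^ m} {l} {seq γ m} {seq γ (suc m)} root (proj₂ γ m))

-- the line λ ↦ λ w + e_j meets Σ a_i y_i² in the quadratic λ² F + λ B + a_j
DQ-full : ∀ {p k} → Prime p → (a w : Fin k → ℕ) (j : Fin k) →
           p ∣ sumF k (λ i → a i * (w i * w i)) → ¬ p ∣ 2 * a j * w j → (γ : Zq p) → InDQ p k a γ
DQ-full {p} {k} p-prime a w j p∣F p∤B γ = y , λ m → subst (λ v → Cong (p ^ m) v (seq γ m)) (sym (form-on-line (seq x m))) (x-root m)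
  where
  open QuadraticHensel {A = a j} p-prime p∣F p∤B
  x = proj₁ (quadratic-onto γ)
  x-root = proj₂ (quadratic-onto γ)
  y : Fin k → Zq p
  y i = (λ m → w i * seq x m + δ j i) , λ m → Cong-affine (w i) (δ j i) (proj₂ x m)
  form-on-line : ∀ l → sumF k (λ i → a i * ((w i * l + δ j i) * (w i * l + δ j i))) ≡ quadratic l
  form-on-line l = begin
    sumF k (λ i → a i * ((w i * l + δ j i) * (w i * l + δ j i)))
      ≡⟨ sumF-cong k (λ i → term (a i) (w i) (δ j i) (δ-idem j i)) ⟩
    sumF k (λ i → l * l * (a i * (w i * w i)) + (l * (2 * a i * w i) + a i) * δ j i)
      ≡⟨ sumF-+ k _ _ ⟩
    sumF k (λ i → l * l * (a i * (w i * w i))) + sumF k (λ i → (l * (2 * a i * w i) + a i) * δ j i)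
      ≡⟨ cong₂ _+_ (sumF-* k (l * l) _) (sumF-δ k j (λ i → l * (2 * a i * w i) + a i)) ⟩
    l * l * sumF k (λ i → a i * (w i * w i)) + (l * (2 * a j * w j) + a j)
      ≡⟨ ℕ.+-assoc (l * l * _) (l * (2 * a j * w j)) (a j) ⟨
    quadratic l ∎
    where
    term : ∀ A W d → d * d ≡ d → A * ((W * l + d) * (W * l + d)) ≡ l * l * (A * (W * W)) + (l * (2 * A * W) + A) * d
    term A W d d²≡d = begin
      A * ((W * l + d) * (W * l + d))                              ≡⟨ expand A W l d ⟩
      l * l * (A * (W * W)) + l * (2 * A * W) * d + A * (d * d)     ≡⟨ cong (λ z → l * l * (A * (W * W)) + l * (2 * A * W) * d + A * z) d²≡d ⟩
      l * l * (A * (W * W)) + l * (2 * A * W) * d + A * d           ≡⟨ collect A W l d ⟩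
      l * l * (A * (W * W)) + (l * (2 * A * W) + A) * d             ∎
      where
      expand : ∀ A W l d → A * ((W * l + d) * (W * l + d)) ≡ l * l * (A * (W * W)) + l * (2 * A * W) * d + A * (d * d)
      expand = solve-∀
      collect : ∀ A W l d → l * l * (A * (W * W)) + l * (2 * A * W) * d + A * d ≡ l * l * (A * (W * W)) + (l * (2 * A * W) + A) * d
      collect = solve-∀

even⊎odd : ∀ n → (∃ λ h → n ≡ 2 * h) ⊎ (∃ λ h → n ≡ suc (2 * h))
even⊎odd zero = inj₁ (0 , refl)
even⊎odd (suc n) with even⊎odd n
... | inj₁ (h , refl) = inj₂ (h , refl)
... | inj₂ (h , refl) = inj₁ (suc h , cong suc (sym (ℕ.+-suc h (h + 0))))

¬2∣⇒odd : ∀ {n} → ¬ 2 ∣ n → ∃ λ h → n ≡ suc (2 * h)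
¬2∣⇒odd {n} 2∤n with even⊎odd n
... | inj₁ (h , n≡2h) = contradiction (divides h (trans n≡2h (ℕ.*-comm 2 h))) 2∤n
... | inj₂ odd        = odd

odd∣odd⇒u≡h : ∀ h u → suc (2 * h) ∣ suc (2 * u) → ∃ λ v → u ≡ suc (2 * h) * v + h
odd∣odd⇒u≡h h u (divides c eq) with even⊎odd c
... | inj₁ (d , refl) = contradiction (sym (trans eq (ℕ.*-assoc 2 d _))) (ℕ.even≢odd (d * suc (2 * h)) u)
... | inj₂ (v , refl) = v , ℕ.*-cancelˡ-≡ u _ 2 (ℕ.suc-injective (trans eq (product-of-odds h v)))
  where
  product-of-odds : ∀ h v → (1 + 2 * v) * (1 + 2 * h) ≡ 1 + 2 * ((1 + 2 * h) * v + h)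
  product-of-odds = solve-∀

odd-prime∤2 : ∀ {p} → Prime p → ¬ 2 ∣ p → ¬ p ∣ 2
odd-prime∤2 p-prime 2∤p p∣2 with irreducible[2] p∣2
... | inj₁ refl = ¬prime[1] p-prime
... | inj₂ refl = 2∤p ℕ∣.∣-refl

triFormℕ : (k : ℕ) → (Fin k → ℕ) → (Fin k → ℕ) → ℕ
triFormℕ k c y = sumF k (λ i → c i * tri (y i))

triForm≡triFormℕ : ∀ k c x → triForm k c x ≡ triFormℕ k c (λ i → reflectNeg (x i))
triForm≡triFormℕ k c x = sumF-cong k (λ i → cong (c i *_) (triZ≡tri∘reflectNeg (x i)))

module WatsonTransform (h : ℕ) (p-prime : Prime (suc (2 * h))) (p∤2 : ¬ suc (2 * h) ∣ 2)
                       {k : ℕ} (a b : Fin k → ℕ) (s : ℕ)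
                       (s-minimal : ∃ λ i → ¬ suc (2 * h) ^ suc s ∣ scaled (suc (2 * h)) a i)
                       (b-watson : ∀ i → suc (2 * h) ^ s * b i ≡ scaled (suc (2 * h)) a i) where

  p : ℕ
  p = suc (2 * h)

  -- the action of λ_p on solutions of T(b)
  φ : Fin k → ℕ → ℕ
  φ i x with p ∣? a i
  ... | yes _ = x
  ... | no  _ = p * x + h

  offset : Fin k → ℕ
  offset i with p ∣? a i
  ... | yes _ = 0
  ... | no  _ = a i * tri h

  D : ℕ
  D = sumF k offset

  a-tri-φ : ∀ i x → a i * tri (φ i x) ≡ scaled p a i * tri x + offset i
  a-tri-φ i x with p ∣? a i
  ... | yes _ = unscaled (a i) (tri x)
    where
    unscaled : ∀ A T → A * T ≡ 1 * A * T + 0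
    unscaled = solve-∀
  ... | no  _ = trans (cong (a i *_) (tri-odd-affine h x)) (distribute p (a i) (tri x) (tri h))
    where
    distribute : ∀ P A T H → A * (P * P * T + H) ≡ P * (P * 1) * A * T + A * H
    distribute = solve-∀

  scaled≡8*offset+a : ∀ i → scaled p a i ≡ 8 * offset i + a i
  scaled≡8*offset+a i with p ∣? a i
  ... | yes _ = ℕ.+-identityʳ (a i)
  ... | no  _ = begin
    p * (p * 1) * a i         ≡⟨ cong (λ z → z * a i) (trans (cong (p *_) (ℕ.*-identityʳ p)) (odd-square h)) ⟩
    (8 * tri h + 1) * a i     ≡⟨ rearrange (a i) (tri h) ⟩
    8 * (a i * tri h) + a i   ∎
    where
    rearrange : ∀ A T → (8 * T + 1) * A ≡ 8 * (A * T) + A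
    rearrange = solve-∀

  p∣scaled : ∀ i → p ∣ scaled p a i
  p∣scaled i with p ∣? a i
  ... | yes p∣a = ℕ∣.∣n⇒∣m*n 1 p∣a
  ... | no  _   = ℕ∣.∣m⇒∣m*n (a i) (ℕ∣.m∣m*n (p * 1))

  p∣p^s : p ∣ p ^ s
  p∣p^s = positive s s-minimal
    where
    positive : ∀ s → (∃ λ i → ¬ p ^ suc s ∣ scaled p a i) → p ∣ p ^ s
    positive zero    (i , p∤scaled) = contradiction (subst (_∣ scaled p a i) (sym (ℕ.*-identityʳ p)) (p∣scaled i)) p∤scaled
    positive (suc s) _              = ℕ∣.m∣m*n (p ^ s)

  form-a∘φ : ∀ X → triFormℕ k a (λ i → φ i (X i)) ≡ p ^ s * triFormℕ k b X + D
  form-a∘φ X = begin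
    triFormℕ k a (λ i → φ i (X i))                           ≡⟨ sumF-cong k (λ i → a-tri-φ i (X i)) ⟩
    sumF k (λ i → scaled p a i * tri (X i) + offset i)       ≡⟨ sumF-+ k _ offset ⟩
    sumF k (λ i → scaled p a i * tri (X i)) + D              ≡⟨ cong (_+ D) (sumF-cong k pull-p^s) ⟩
    sumF k (λ i → p ^ s * (b i * tri (X i))) + D             ≡⟨ cong (_+ D) (sumF-* k (p ^ s) _) ⟩
    p ^ s * triFormℕ k b X + D                               ∎
    where
    pull-p^s : ∀ i → scaled p a i * tri (X i) ≡ p ^ s * (b i * tri (X i))
    pull-p^s i = trans (cong (_* tri (X i)) (sym (b-watson i))) (ℕ.*-assoc (p ^ s) (b i) (tri (X i)))

  φ-Cong : ∀ i {n u v} → Cong n u v → Cong n (φ i u) (φ i v)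
  φ-Cong i {n} {u} {v} u≡v with p ∣? a i
  ... | yes _ = u≡v
  ... | no  _ = Cong-affine {n} {u} {v} p h u≡v

  LocRepAt-φ : ∀ q n → LocRepAt q k b n → LocRepAt q k a (p ^ s * n + D)
  LocRepAt-φ q n (x , x-sol) = x′ , λ m → subst (λ v → Cong (q ^ m) v (p ^ s * n + D)) (sym (value m)) (Cong-affine (p ^ s) D (x-sol m))
    where
    x′ : Fin k → Zq q
    x′ i = (λ m → φ i (seq (x i) m)) , (λ m → φ-Cong i (proj₂ (x i) m))
    triN-form : ∀ c X → sumF k (λ i → c i * triN (X i)) ≡ triFormℕ k c X
    triN-form c X = sumF-cong k (λ i → cong (c i *_) (triN≡tri (X i)))
    value : ∀ m → sumF k (λ i → a i * triN (seq (x′ i) (suc m))) ≡ p ^ s * sumF k (λ i → b i * triN (seq (x i) (suc m))) + D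
    value m = begin
      sumF k (λ i → a i * triN (seq (x′ i) (suc m)))             ≡⟨ triN-form a (λ i → φ i (seq (x i) (suc m))) ⟩
      triFormℕ k a (λ i → φ i (seq (x i) (suc m)))               ≡⟨ form-a∘φ (λ i → seq (x i) (suc m)) ⟩
      p ^ s * triFormℕ k b (λ i → seq (x i) (suc m)) + D          ≡⟨ cong (λ z → p ^ s * z + D) (triN-form b (λ i → seq (x i) (suc m))) ⟨
      p ^ s * sumF k (λ i → b i * triN (seq (x i) (suc m))) + D   ∎

  Liftable : (Fin k → ℕ) → Fin k → Set
  Liftable u i = p ∣ a i ⊎ p ∣ suc (2 * u i)

  Liftable? : ∀ u i → Dec (Liftable u i)
  Liftable? u i = (p ∣? a i) ⊎-dec (p ∣? suc (2 * u i))

  φ-preimage : ∀ u i → Liftable u i → ∃ λ v → φ i v ≡ u i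
  φ-preimage u i liftable with p ∣? a i | liftable
  ... | yes _   | _            = u i , refl
  ... | no  p∤a | inj₁ p∣a     = contradiction p∣a p∤a
  ... | no  _   | inj₂ p∣2u+1  = let v , u≡ = odd∣odd⇒u≡h h (u i) p∣2u+1 in v , sym u≡

  p∤derivative : ∀ u j → ¬ Liftable u j → ¬ p ∣ 2 * a j * suc (2 * u j)
  p∤derivative u j unliftable p∣ with euclidsLemma (2 * a j) (suc (2 * u j)) p-prime p∣
  ... | inj₂ p∣2u+1 = unliftable (inj₂ p∣2u+1)
  ... | inj₁ p∣2a with euclidsLemma 2 (a j) p-prime p∣2a
  ...   | inj₁ p∣2 = p∤2 p∣2
  ...   | inj₂ p∣a = unliftable (inj₁ p∣a)

  -- 8 T(u) + 1 = (2u + 1)² turns a solution of the triangular equation into a value of Σ a_i y_i² divisible by p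
  p∣odd-form : ∀ n u → triFormℕ k a u ≡ p ^ s * n + D → p ∣ sumF k (λ i → a i * (suc (2 * u i) * suc (2 * u i)))
  p∣odd-form n u u-sol = subst (p ∣_) (sym odd-form≡) (ℕ∣.∣m∣n⇒∣m+n p∣8p^sn (∣-sumF k (scaled p a) p∣scaled))
    where
    p∣8p^sn : p ∣ 8 * (p ^ s * n)
    p∣8p^sn = ℕ∣.∣n⇒∣m*n 8 (ℕ∣.∣m⇒∣m*n n p∣p^s)
    odd-form≡ : sumF k (λ i → a i * (suc (2 * u i) * suc (2 * u i))) ≡ 8 * (p ^ s * n) + sumF k (scaled p a)
    odd-form≡ = begin
      sumF k (λ i → a i * (suc (2 * u i) * suc (2 * u i)))   ≡⟨ sumF-cong k (λ i → cong (a i *_) (odd-square (u i))) ⟩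
      sumF k (λ i → a i * (8 * tri (u i) + 1))                ≡⟨ sumF-cong k (λ i → expand (a i) (tri (u i))) ⟩
      sumF k (λ i → 8 * (a i * tri (u i)) + a i)              ≡⟨ sumF-+ k _ a ⟩
      sumF k (λ i → 8 * (a i * tri (u i))) + sumF k a         ≡⟨ cong (_+ sumF k a) (trans (sumF-* k 8 _) (cong (8 *_) u-sol)) ⟩
      8 * (p ^ s * n + D) + sumF k a                          ≡⟨ regroup (p ^ s * n) D (sumF k a) ⟩
      8 * (p ^ s * n) + (8 * D + sumF k a)                    ≡⟨ cong (λ z → 8 * (p ^ s * n) + z) offsets ⟩
      8 * (p ^ s * n) + sumF k (scaled p a)                   ∎
      where
      expand : ∀ A T → A * (8 * T + 1) ≡ 8 * (A * T) + A
      expand = solve-∀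
      regroup : ∀ X D S → 8 * (X + D) + S ≡ 8 * X + (8 * D + S)
      regroup = solve-∀
      offsets : 8 * D + sumF k a ≡ sumF k (scaled p a)
      offsets = begin
        8 * D + sumF k a                       ≡⟨ cong (_+ sumF k a) (sumF-* k 8 offset) ⟨
        sumF k (λ i → 8 * offset i) + sumF k a ≡⟨ sumF-+ k (λ i → 8 * offset i) a ⟨
        sumF k (λ i → 8 * offset i + a i)      ≡⟨ sumF-cong k (λ i → sym (scaled≡8*offset+a i)) ⟩
        sumF k (scaled p a)                    ∎

  represents-or-DQ-full : ∀ n u → triFormℕ k a u ≡ p ^ s * n + D →
                          Represents k b n ⊎ ((γ : Zq p) → InDQ p k a γ)
  represents-or-DQ-full n u u-sol with all? (Liftable? u)
  ... | yes liftable = inj₁ ((λ i → + v i) , trans (triForm≡triFormℕ k b (λ i → + v i)) b-form-v≡n)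
    where
    v : Fin k → ℕ
    v i = proj₁ (φ-preimage u i (liftable i))
    b-form-v≡n : triFormℕ k b v ≡ n
    b-form-v≡n = ℕ.*-cancelˡ-≡ _ n (p ^ s) {{ℕ.m^n≢0 p s}} (ℕ.+-cancelʳ-≡ D _ _ (begin
      p ^ s * triFormℕ k b v + D       ≡⟨ form-a∘φ v ⟨
      triFormℕ k a (λ i → φ i (v i))   ≡⟨ sumF-cong k (λ i → cong (λ z → a i * tri z) (proj₂ (φ-preimage u i (liftable i)))) ⟩
      triFormℕ k a u                   ≡⟨ u-sol ⟩
      p ^ s * n + D                    ∎))
  ... | no ¬liftable = inj₂ (DQ-full p-prime a (λ i → suc (2 * u i)) j (p∣odd-form n u u-sol) (p∤derivative u j j-unliftable))
    where
    j-witness = ¬∀⟶∃¬ k (Liftable u) (Liftable? u) ¬liftable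
    j = proj₁ j-witness
    j-unliftable = proj₂ j-witness

  regular : Regular k a → Unstable p k a → Regular k b
  regular a-regular (γ , γ∉DQ) n n>0 n-local = [ id , (λ full → contradiction (full γ) γ∉DQ) ]′ (represents-or-DQ-full n u u-sol)
    where
    n′ = p ^ s * n + D
    n′>0 : 0 < n′
    n′>0 = ℕ.m≤n⇒m≤n+o D (ℕ.>-nonZero⁻¹ (p ^ s * n) {{ℕ.m*n≢0 (p ^ s) n {{ℕ.m^n≢0 p s}} {{ℕ.>-nonZero n>0}}}})
    represented = a-regular n′ n′>0 (λ q q-prime → LocRepAt-φ q n (n-local q q-prime))
    u : Fin k → ℕ
    u i = reflectNeg (proj₁ represented i)
    u-sol : triFormℕ k a u ≡ n′
    u-sol = trans (sym (triForm≡triFormℕ k a (proj₁ represented))) (proj₂ represented)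

proposition3p6 : (p : ℕ) → Prime p → ¬ (2 ∣ p) →
    (k : ℕ) → 4 ≤ k → (a : Fin k → ℕ) → ((i : Fin k) → 0 < a i) →
    gcdF k a ≡ 1 → Regular k a → Unstable p k a →
    (b : Fin k → ℕ) → IsWatson p k a b → Regular k b
proposition3p6 p p-prime 2∤p k _ a _ _ a-regular unstable b (s , (_ , s-minimal) , b-watson) with ¬2∣⇒odd 2∤p
... | h , refl = WatsonTransform.regular h p-prime (odd-prime∤2 p-prime 2∤p) a b s s-minimal b-watson a-regular unstable
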